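{- $\mathsf{No}$ is an abelian group: for all $x,y,z:\mathsf{No}$, (1) $x+0=x$; (2) $x+(-x)=0$; (3) $x+(y+z)=(x+y)+z$; (4) $x+y=y+x$.
   Context: $\mathsf{No}$ is the higher inductive-inductive type of surreal numbers with simultaneously defined mere-proposition-valued relations $<,\le$: for types $\mathcal{L},\mathcal{R}$ and $x^L:\mathcal{L}\to\mathsf{No}$, $x^R:\mathcal{R}\to\mathsf{No}$ with $x^L<x^R$ for all $L,R$ there is $\{x^L\mid x^R\}:\mathsf{No}$; $x\le y$ and $y\le x$ imply $x=y$; for cuts $x,y$, $x<y$ if there is $L$ with $x\le y^L$ or $R$ with $x^R\le y$, and $x\le y$ if $x^L<y$ for all $L$ and $x<y^R$ for all $R$. $0=\{\ \mid\ \}$. Addition is defined recursively by $x+y=\{x^L+y,\,x+y^L\mid x^R+y,\,x+y^R\}$ and negation by $-x=\{ -x^R\mid -x^L\}$. -}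

module Defs where

open import Data.Empty using (⊥)
open import Data.Sum using (_⊎_; inj₁; inj₂; [_,_])
open import Data.Product using (Σ; _×_; _,_; proj₁)

-- Conway pre-games: cuts {xᴸ | xᴿ} indexed by arbitrary types L, R : Set
-- (the "types 𝓛, 𝓡" of the HIIT No, living in a fixed universe).
data Game : Set₁ where
  cut : (L R : Set) → (L → Game) → (R → Game) → Game

Lᵗ : Game → Set
Lᵗ (cut L _ _ _) = L

Rᵗ : Game → Set
Rᵗ (cut _ R _ _) = R

left : (x : Game) → Lᵗ x → Game
left (cut _ _ xl _) = xl

right : (x : Game) → Rᵗ x → Game
right (cut _ _ _ xr) = xr

data _≤_ : Game → Game → Set₁
data _<_ : Game → Game → Set₁

data _≤_ where
  le : ∀ {x y} → (∀ (l : Lᵗ x) → left x l < y) → (∀ (r : Rᵗ y) → x < right y r) → x ≤ y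

data _<_ where
  ltL : ∀ {x y} (l : Lᵗ y) → x ≤ left y l → x < y
  ltR : ∀ {x y} (r : Rᵗ x) → right x r ≤ y → x < y

infix 4 _≤_ _<_ _≈_

-- The path constructor of No (x ≤ y → y ≤ x → x = y) is rendered as the
-- setoid equality on representatives.
_≈_ : Game → Game → Set₁
x ≈ y = (x ≤ y) × (y ≤ x)

data IsNumber : Game → Set₁ where
  num : ∀ {L R} {xl : L → Game} {xr : R → Game} →
        (∀ l → IsNumber (xl l)) → (∀ r → IsNumber (xr r)) →
        (∀ l r → xl l < xr r) → IsNumber (cut L R xl xr)

-- Surreal numbers (as representatives; equality is _≈_).
No : Set₁
No = Σ Game IsNumber

0ᴳ : Game
0ᴳ = cut ⊥ ⊥ (λ ()) (λ ())

infixl 6 _+ᴳ_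
_+ᴳ_ : Game → Game → Game
cut Lx Rx xl xr +ᴳ cut Ly Ry yl yr =
  cut (Lx ⊎ Ly) (Rx ⊎ Ry)
      [ (λ l → xl l +ᴳ cut Ly Ry yl yr) , (λ l → cut Lx Rx xl xr +ᴳ yl l) ]
      [ (λ r → xr r +ᴳ cut Ly Ry yl yr) , (λ r → cut Lx Rx xl xr +ᴳ yr r) ]

-ᴳ_ : Game → Game
-ᴳ cut L R xl xr = cut R L (λ r → -ᴳ xr r) (λ l → -ᴳ xl l)

{-# OPTIONS --safe #-}
module Submission where

open import Defs
open import Data.Empty using (⊥-elim)
open import Data.Product using (_×_; proj₁; proj₂; _,_)
open import Data.Sum using (inj₁; inj₂; [_,_]; swap; assocˡ; assocʳ; fromInj₁)

-- Up to relabelling the index types of their options, x + 0, y + x and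
-- (x + y) + z have literally the same options as x, x + y and x + (y + z), and
-- such identical games are equal.  For x + (-x) ≤ 0, each left move of
-- x + (-x) is answered by the mirrored right move, reaching xᴸ - xᴸ or
-- xᴿ - xᴿ, which is ≤ 0 by induction; 0 ≤ x + (-x) is dual.

infix 4 _≅_

data _≅_ : Game → Game → Set₁ where
  identical : ∀ {x y} →
    (fL : Lᵗ x → Lᵗ y) → (∀ l → left x l ≅ left y (fL l)) →
    (gL : Lᵗ y → Lᵗ x) → (∀ l → left x (gL l) ≅ left y l) →
    (fR : Rᵗ x → Rᵗ y) → (∀ r → right x r ≅ right y (fR r)) →
    (gR : Rᵗ y → Rᵗ x) → (∀ r → right x (gR r) ≅ right y r) →
    x ≅ y

≅⇒≈ : ∀ {x y} → x ≅ y → x ≈ y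
≅⇒≈ (identical fL fL≅ gL gL≅ fR fR≅ gR gR≅) =
  le (λ l → ltL (fL l) (proj₁ (≅⇒≈ (fL≅ l)))) (λ r → ltR (gR r) (proj₁ (≅⇒≈ (gR≅ r)))) ,
  le (λ l → ltL (gL l) (proj₂ (≅⇒≈ (gL≅ l)))) (λ r → ltR (fR r) (proj₂ (≅⇒≈ (fR≅ r))))

+-identityʳ-≅ : ∀ x → x +ᴳ 0ᴳ ≅ x
+-identityʳ-≅ (cut L R xl xr) =
  identical (fromInj₁ ⊥-elim) [ (λ l → +-identityʳ-≅ (xl l)) , (λ ()) ]
            inj₁              (λ l → +-identityʳ-≅ (xl l))
            (fromInj₁ ⊥-elim) [ (λ r → +-identityʳ-≅ (xr r)) , (λ ()) ]
            inj₁              (λ r → +-identityʳ-≅ (xr r))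

+-comm-≅ : ∀ x y → x +ᴳ y ≅ y +ᴳ x
+-comm-≅ x@(cut _ _ xl xr) y@(cut _ _ yl yr) =
  identical swap [ (λ l → +-comm-≅ (xl l) y) , (λ l → +-comm-≅ x (yl l)) ]
            swap [ (λ l → +-comm-≅ x (yl l)) , (λ l → +-comm-≅ (xl l) y) ]
            swap [ (λ r → +-comm-≅ (xr r) y) , (λ r → +-comm-≅ x (yr r)) ]
            swap [ (λ r → +-comm-≅ x (yr r)) , (λ r → +-comm-≅ (xr r) y) ]

+-assoc-≅ : ∀ x y z → x +ᴳ (y +ᴳ z) ≅ (x +ᴳ y) +ᴳ z
+-assoc-≅ x@(cut _ _ xl xr) y@(cut _ _ yl yr) z@(cut _ _ zl zr) =
  identical
    assocˡ [ (λ l → +-assoc-≅ (xl l) y z) , [ (λ l → +-assoc-≅ x (yl l) z) , (λ l → +-assoc-≅ x y (zl l)) ] ]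
    assocʳ [ [ (λ l → +-assoc-≅ (xl l) y z) , (λ l → +-assoc-≅ x (yl l) z) ] , (λ l → +-assoc-≅ x y (zl l)) ]
    assocˡ [ (λ r → +-assoc-≅ (xr r) y z) , [ (λ r → +-assoc-≅ x (yr r) z) , (λ r → +-assoc-≅ x y (zr r)) ] ]
    assocʳ [ [ (λ r → +-assoc-≅ (xr r) y z) , (λ r → +-assoc-≅ x (yr r) z) ] , (λ r → +-assoc-≅ x y (zr r)) ]

ltL-+ˡ : ∀ x y {z} (l : Lᵗ x) → z ≤ left x l +ᴳ y → z < x +ᴳ y
ltL-+ˡ (cut _ _ _ _) (cut _ _ _ _) l = ltL (inj₁ l)

ltL-+ʳ : ∀ x y {z} (l : Lᵗ y) → z ≤ x +ᴳ left y l → z < x +ᴳ y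
ltL-+ʳ (cut _ _ _ _) (cut _ _ _ _) l = ltL (inj₂ l)

ltR-+ˡ : ∀ x y {z} (r : Rᵗ x) → right x r +ᴳ y ≤ z → x +ᴳ y < z
ltR-+ˡ (cut _ _ _ _) (cut _ _ _ _) r = ltR (inj₁ r)

ltR-+ʳ : ∀ x y {z} (r : Rᵗ y) → x +ᴳ right y r ≤ z → x +ᴳ y < z
ltR-+ʳ (cut _ _ _ _) (cut _ _ _ _) r = ltR (inj₂ r)

+-inverseʳ-≤ : ∀ x → x +ᴳ (-ᴳ x) ≤ 0ᴳ
+-inverseʳ-≤ x@(cut _ _ xl xr) =
  le [ (λ l → ltR-+ʳ (xl l) (-ᴳ x) l (+-inverseʳ-≤ (xl l)))
     , (λ r → ltR-+ˡ x (-ᴳ xr r) r (+-inverseʳ-≤ (xr r))) ]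
     (λ ())

+-inverseʳ-≥ : ∀ x → 0ᴳ ≤ x +ᴳ (-ᴳ x)
+-inverseʳ-≥ x@(cut _ _ xl xr) =
  le (λ ())
     [ (λ r → ltL-+ʳ (xr r) (-ᴳ x) r (+-inverseʳ-≥ (xr r)))
     , (λ l → ltL-+ˡ x (-ᴳ xl l) l (+-inverseʳ-≥ (xl l))) ]

+-inverseʳ : ∀ x → x +ᴳ (-ᴳ x) ≈ 0ᴳ
+-inverseʳ x = +-inverseʳ-≤ x , +-inverseʳ-≥ x

mainTheorem10 : (x y z : No) →
    (proj₁ x +ᴳ 0ᴳ ≈ proj₁ x)
    × (proj₁ x +ᴳ (-ᴳ proj₁ x) ≈ 0ᴳ)
    × (proj₁ x +ᴳ (proj₁ y +ᴳ proj₁ z) ≈ (proj₁ x +ᴳ proj₁ y) +ᴳ proj₁ z)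
    × (proj₁ x +ᴳ proj₁ y ≈ proj₁ y +ᴳ proj₁ x)
mainTheorem10 (x , _) (y , _) (z , _) =
    ≅⇒≈ (+-identityʳ-≅ x)
  , +-inverseʳ x
  , ≅⇒≈ (+-assoc-≅ x y z)
  , ≅⇒≈ (+-comm-≅ x y)
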